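{- Let $\varphi$ be a skew morphism of a finite cyclic group $B$ with power function $\pi$, let $b$ be a generator of $B$, let $G=B\langle\varphi\rangle$, let $\overline{\varphi}$ be the quotient of $\varphi$ with respect to $b$ with power function $\overline{\pi}$, and let $\overline{c}$ be the image of $\varphi$ (as an element of $G$) under the natural homomorphism $G\to G/\ker\varphi$. Then for every positive integer $k$: (a) $\overline{c}^{\,\pi(b^k)}=\overline{\varphi}^{\,k}(\overline{c})$; (b) $\varphi^k(b)$ and $b^{\overline{\pi}(\overline{c}^{\,k})}$ belong to the same coset of $\ker\varphi$ in $B$.
   Context: For a finite group $B$, a skew morphism of $B$ is a permutation $\varphi$ of $B$ fixing the identity such that for every $a\in B$ there is a positive integer $i_a$ with $\varphi(ab)=\varphi(a)\varphi^{i_a}(b)$ for all $b\in B$. Its order $\mathrm{ord}(\varphi)$ is the order of $\langle\varphi\rangle$; the power function $\pi$ maps $a$ to the unique such $i_a\in\{1,\dots,\mathrm{ord}(\varphi)\}$ (with $\pi\equiv1$ for the identity); $\ker\varphi=\{a:\pi(a)=1\}$. Quotient: for $B$ cyclic, identify $B$ with its left regular action in $\mathrm{Sym}(B)$, let $C=\langle\varphi\rangle$ and $G=BC\le\mathrm{Sym}(B)$ (a group with $B\cap C=1$); write $c$ for $\varphi$ as an element of $G$. Then $K=\ker\varphi$ is normal in $G$ (the core of $B$ in $G$). Write $\overline{g}=gK$ and $\overline{X}=XK/K$; $\overline{C}\cong C$ is cyclic and $\overline{B}\cap\overline{C}=1$. For a generator $b$ of $B$, each $\overline{d}\in\overline{C}$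 satisfies $\overline{d}\,\overline{b}=\overline{b}^{\,j}\overline{d'}$ for unique $\overline{d'}\in\overline{C}$ and unique $j\in\{1,\dots,|\overline B|\}$; the map $\overline\varphi:\overline d\mapsto\overline{d'}$ is a skew morphism of $\overline C$ with power function $\overline\pi(\overline d)=j$, called the quotient of $\varphi$ with respect to $b$. -}

module Defs where

open import Data.Nat using (ℕ; zero; suc; _+_; _*_; _≤_; _<_; NonZero)
open import Data.Nat.DivMod using (_mod_)
open import Data.Fin using (Fin; toℕ; zero)
open import Data.Product using (Σ; _×_; ∃)
open import Relation.Binary.PropositionalEquality using (_≡_)
open import Relation.Nullary using (¬_)
open import Function using (_∘_)

-- The finite cyclic group B is modelled as ℤ_n = Fin n (n ≥ 1) under
-- addition modulo n (written multiplicatively in the paper).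
module _ (n : ℕ) .{{_ : NonZero n}} where

  _⊕_ : Fin n → Fin n → Fin n
  a ⊕ b = (toℕ a + toℕ b) mod n

  pow : Fin n → ℕ → Fin n
  pow b k = (k * toℕ b) mod n

  lreg : Fin n → Fin n → Fin n
  lreg a x = a ⊕ x

  IsGenerator : Fin n → Set
  IsGenerator b = ∀ (a : Fin n) → Σ ℕ λ k → a ≡ pow b k

iter : {A : Set} → (A → A) → ℕ → A → A
iter f zero x = x
iter f (suc k) x = f (iter f k x)

module _ {n : ℕ} .{{_ : NonZero n}} where

  private
    _·_ : Fin n → Fin n → Fin n
    _·_ = _⊕_ n

  -- skew morphism of B: a permutation (injective self-map of a finite set)
  -- fixing the identity, with the skew-product rule
  record IsSkewMorphism (φ : Fin n → Fin n) : Set where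
    field
      injective : ∀ x y → φ x ≡ φ y → x ≡ y
      fixes-id  : φ (0 mod n) ≡ 0 mod n
      skew      : ∀ a → Σ ℕ λ i → (1 ≤ i) × (∀ b → φ (a · b) ≡ φ a · iter φ i b)

  IsOrder : (Fin n → Fin n) → ℕ → Set
  IsOrder φ r = (1 ≤ r) × (∀ x → iter φ r x ≡ x)
              × (∀ s → 1 ≤ s → s < r → ¬ (∀ x → iter φ s x ≡ x))

  IsPower : (Fin n → Fin n) → ℕ → Fin n → ℕ → Set
  IsPower φ r a i = (1 ≤ i) × (i ≤ r) × (∀ b → φ (a · b) ≡ φ a · iter φ i b)

  InKer : (Fin n → Fin n) → Fin n → Set
  InKer φ a = ∀ b → φ (a · b) ≡ φ a · φ b

  -- elements of G ≤ Sym(B) are maps Fin n → Fin n; product = composition.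
  -- gK = hK  iff  h = g ∘ λ_κ for some κ ∈ K = ker φ
  SameCosetG : (Fin n → Fin n) → (Fin n → Fin n) → (Fin n → Fin n) → Set
  SameCosetG φ g h = Σ (Fin n) λ κ → InKer φ κ × (∀ x → h x ≡ g (κ · x))

  SameCosetB : (Fin n → Fin n) → Fin n → Fin n → Set
  SameCosetB φ a a' = Σ (Fin n) λ κ → InKer φ κ × (a' ≡ a · κ)

  -- s = |B̄| = order of b̄ in G/K (b̄ generates B̄)
  IsQuotOrder : (Fin n → Fin n) → Fin n → ℕ → Set
  IsQuotOrder φ b s = (1 ≤ s) × InKer φ (pow n b s)
                    × (∀ t → 1 ≤ t → t < s → ¬ InKer φ (pow n b t))

  -- Quotient relation: c̄^e b̄ = b̄^j c̄^e'  (in G/K), written for coset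
  -- representatives c^e, b, b^j, c^e' ∈ G.
  QuotRel : (Fin n → Fin n) → Fin n → ℕ → ℕ → ℕ → Set
  QuotRel φ b e j e' =
    SameCosetG φ (iter φ e ∘ lreg n b) (lreg n (pow n b j) ∘ iter φ e')

  -- φ̄ (c̄^e) = c̄^e' : there is an exponent j with c̄^e b̄ = b̄^j c̄^e'
  QuotSkewStep : (Fin n → Fin n) → Fin n → ℕ → ℕ → Set
  QuotSkewStep φ b e e' = Σ ℕ λ j → QuotRel φ b e j e'

{-# OPTIONS --safe #-}
module Submission where

-- Write G = B⟨φ⟩ ≤ Sym(B) and K = ker φ. For (a), the quotient relations c̄^{e_i} b̄ = b̄^{j_i} c̄^{e_{i+1}}
-- give by induction c λ_{b^m} ∈ λ_B c^{e_m} λ_K for m ≤ k, while the skew rule gives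
-- c λ_{b^k} = λ_{φ(b^k)} c^{π(b^k)}. A factorisation in λ_B c^e λ_K determines c^e, since K is
-- φ-invariant and φ is a homomorphism on K; hence c^{π(b^k)} = c^{e_k}. For (b), evaluating
-- c^k λ_b λ_κ = λ_{b^j} c^{e'} at the identity gives b^j = φ^k(κ b) = φ^k(b) φ^k(κ) with φ^k(κ) ∈ K.
-- K is φ-invariant because for a ∈ K the order of φ(a) divides that of a, and in a cyclic group
-- every such element lies in ⟨a⟩ ⊆ K.

open import Defs
open import Algebra.Bundles using (AbelianGroup; Group)
open import Algebra.Structures using (IsAbelianGroup)
import Algebra.Properties.AbelianGroup as AbelianGroupProperties
import Algebra.Properties.CommutativeSemigroup as CommutativeSemigroupProperties
open import Data.Nat using (ℕ; zero; suc; _+_; _*_; _%_; _≤_; _<_; pred; NonZero)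
open import Data.Nat.Properties using (+-comm; +-assoc; *-comm; *-assoc; suc-pred; ≤-refl; <⇒≤; m*n≢0⇒m≢0)
open import Data.Nat.DivMod using (_mod_; m%n<n; m<n⇒m%n≡m; %-distribˡ-+; m*n%n≡0)
open import Data.Nat.Divisibility using (_∣_; divides; m%n≡0⇒n∣m; *-cancelˡ-∣)
open import Data.Nat.GCD using (gcd; gcd-GCD; gcd[m,n]∣m; gcd[m,n]∣n; module Bézout)
open import Data.Fin using (Fin; toℕ)
open import Data.Fin.Properties using (toℕ-fromℕ<; fromℕ<-cong; toℕ-injective; toℕ<n)
open import Data.Product using (_×_; _,_)
open import Function using (_∘_; it)
open import Relation.Binary.PropositionalEquality

module ℤₙ (n : ℕ) .{{_ : NonZero n}} where

  ι : ℕ → Fin n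
  ι t = t mod n

  toℕ-ι : ∀ t → toℕ (ι t) ≡ t % n
  toℕ-ι t = toℕ-fromℕ< (m%n<n t n)

  ι-cong-% : ∀ a b → a % n ≡ b % n → ι a ≡ ι b
  ι-cong-% a b eq = fromℕ<-cong _ _ eq (m%n<n a n) (m%n<n b n)

  ι-toℕ : ∀ x → ι (toℕ x) ≡ x
  ι-toℕ x = toℕ-injective (trans (toℕ-ι (toℕ x)) (m<n⇒m%n≡m (toℕ<n x)))

  infixl 6 _∙_
  _∙_ : Fin n → Fin n → Fin n
  _∙_ = _⊕_ n

  ε : Fin n
  ε = ι 0

  -- −x is taken to be (n − 1)·x, so that every set closed under powers is closed under negation.
  _⁻¹ : Fin n → Fin n
  x ⁻¹ = pow n x (pred n)

  ι-+ : ∀ a b → ι (a + b) ≡ ι a ∙ ι b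
  ι-+ a b = ι-cong-% (a + b) (toℕ (ι a) + toℕ (ι b)) (begin
    (a + b) % n                         ≡⟨ %-distribˡ-+ a b n ⟩
    (a % n + b % n) % n                 ≡⟨ sym (cong₂ (λ u v → (u + v) % n) (toℕ-ι a) (toℕ-ι b)) ⟩
    (toℕ (ι a) + toℕ (ι b)) % n         ∎)
    where open ≡-Reasoning

  ι-*n : ∀ k → ι (k * n) ≡ ε
  ι-*n k = ι-cong-% (k * n) 0 (trans (m*n%n≡0 k n) (sym (m*n%n≡0 0 n)))

  ι≡ε⇒∣ : ∀ m → ι m ≡ ε → n ∣ m
  ι≡ε⇒∣ m eq = m%n≡0⇒n∣m m n (begin
    m % n          ≡⟨ sym (toℕ-ι m) ⟩
    toℕ (ι m)      ≡⟨ cong toℕ eq ⟩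
    toℕ (ι 0)      ≡⟨ toℕ-ι 0 ⟩
    0 % n          ≡⟨ m*n%n≡0 0 n ⟩
    0              ∎)
    where open ≡-Reasoning

  ∙-comm : ∀ x y → x ∙ y ≡ y ∙ x
  ∙-comm x y = cong ι (+-comm (toℕ x) (toℕ y))

  ∙-assoc : ∀ x y z → (x ∙ y) ∙ z ≡ x ∙ (y ∙ z)
  ∙-assoc x y z = begin
    (x ∙ y) ∙ z                    ≡⟨ cong ((x ∙ y) ∙_) (sym (ι-toℕ z)) ⟩
    ι (toℕ x + toℕ y) ∙ ι (toℕ z)  ≡⟨ sym (ι-+ (toℕ x + toℕ y) (toℕ z)) ⟩
    ι (toℕ x + toℕ y + toℕ z)      ≡⟨ cong ι (+-assoc (toℕ x) (toℕ y) (toℕ z)) ⟩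
    ι (toℕ x + (toℕ y + toℕ z))    ≡⟨ ι-+ (toℕ x) (toℕ y + toℕ z) ⟩
    ι (toℕ x) ∙ (y ∙ z)            ≡⟨ cong (_∙ (y ∙ z)) (ι-toℕ x) ⟩
    x ∙ (y ∙ z)                    ∎
    where open ≡-Reasoning

  ∙-identityˡ : ∀ x → ε ∙ x ≡ x
  ∙-identityˡ x = begin
    ε ∙ x            ≡⟨ cong (ε ∙_) (sym (ι-toℕ x)) ⟩
    ι 0 ∙ ι (toℕ x)  ≡⟨ sym (ι-+ 0 (toℕ x)) ⟩
    ι (toℕ x)        ≡⟨ ι-toℕ x ⟩
    x                ∎
    where open ≡-Reasoning

  pow-suc : ∀ x m → pow n x (suc m) ≡ x ∙ pow n x m
  pow-suc x m = trans (ι-+ (toℕ x) (m * toℕ x)) (cong (_∙ pow n x m) (ι-toℕ x))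

  pow-ι : ∀ t w → pow n (ι t) w ≡ ι (w * t)
  pow-ι t zero = refl
  pow-ι t (suc w) = begin
    pow n (ι t) (suc w)  ≡⟨ pow-suc (ι t) w ⟩
    ι t ∙ pow n (ι t) w  ≡⟨ cong (ι t ∙_) (pow-ι t w) ⟩
    ι t ∙ ι (w * t)      ≡⟨ sym (ι-+ t (w * t)) ⟩
    ι (suc w * t)        ∎
    where open ≡-Reasoning

  ∙-inverseˡ : ∀ x → x ⁻¹ ∙ x ≡ ε
  ∙-inverseˡ x = begin
    x ⁻¹ ∙ x                      ≡⟨ cong (x ⁻¹ ∙_) (sym (ι-toℕ x)) ⟩
    ι (pred n * t) ∙ ι t          ≡⟨ sym (ι-+ (pred n * t) t) ⟩
    ι (pred n * t + t)            ≡⟨ cong ι (+-comm (pred n * t) t) ⟩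
    ι (suc (pred n) * t)          ≡⟨ cong (λ m → ι (m * t)) (suc-pred n) ⟩
    ι (n * t)                     ≡⟨ cong ι (*-comm n t) ⟩
    ι (t * n)                     ≡⟨ ι-*n t ⟩
    ε                             ∎
    where
      open ≡-Reasoning
      t = toℕ x

  isAbelianGroup : IsAbelianGroup _≡_ _∙_ ε _⁻¹
  isAbelianGroup = record
    { isGroup = record
      { isMonoid = record
        { isSemigroup = record
          { isMagma = record { isEquivalence = isEquivalence ; ∙-cong = cong₂ _∙_ }
          ; assoc = ∙-assoc
          }
        ; identity = ∙-identityˡ , λ x → trans (∙-comm x ε) (∙-identityˡ x)
        }
      ; inverse = ∙-inverseˡ , λ x → trans (∙-comm x (x ⁻¹)) (∙-inverseˡ x)
      ; ⁻¹-cong = cong _⁻¹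
      }
    ; comm = ∙-comm
    }

  abelianGroup : AbelianGroup _ _
  abelianGroup = record { isAbelianGroup = isAbelianGroup }

  open AbelianGroup abelianGroup public using (identityˡ; identityʳ; commutativeSemigroup; group)
  open Group group public using (_\\_)
  open AbelianGroupProperties abelianGroup public
    using (∙-cancelˡ; inverseˡ-unique; \\-leftDividesˡ)
  open CommutativeSemigroupProperties commutativeSemigroup public
    using (x∙yz≈y∙xz; xy∙z≈y∙xz)

  pow-ε-by-cofactor : ∀ q {d} x → q * d ≡ n → d ∣ toℕ x → pow n x q ≡ ε
  pow-ε-by-cofactor q {d} x qd≡n (divides s t≡sd) = begin
    ι (q * toℕ x)   ≡⟨ cong (λ t → ι (q * t)) t≡sd ⟩
    ι (q * (s * d)) ≡⟨ cong ι (trans (sym (*-assoc q s d)) (cong (_* d) (*-comm q s))) ⟩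
    ι (s * q * d)   ≡⟨ cong ι (trans (*-assoc s q d) (cong (s *_) qd≡n)) ⟩
    ι (s * n)       ≡⟨ ι-*n s ⟩
    ε               ∎
    where open ≡-Reasoning

  pow-ε⇒cofactor∣ : ∀ q {d} y → q * d ≡ n → pow n y q ≡ ε → d ∣ toℕ y
  pow-ε⇒cofactor∣ q {d} y qd≡n qy≡ε = *-cancelˡ-∣ q (subst (_∣ q * toℕ y) (sym qd≡n) n∣qy)
    where
      instance
        q≢0 : NonZero q
        q≢0 = m*n≢0⇒m≢0 q {{subst NonZero (sym qd≡n) it}}
      n∣qy : n ∣ q * toℕ y
      n∣qy = ι≡ε⇒∣ (q * toℕ y) qy≡ε

  record IsSubmonoid (P : Fin n → Set) : Set where
    field
      ε-closed : P ε
      ∙-closed : ∀ {x y} → P x → P y → P (x ∙ y)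

    pow-closed : ∀ {x} m → P x → P (pow n x m)
    pow-closed zero px = ε-closed
    pow-closed {x} (suc m) px = subst P (sym (pow-suc x m)) (∙-closed px (pow-closed m px))

    ⁻¹-closed : ∀ {x} → P x → P (x ⁻¹)
    ⁻¹-closed = pow-closed (pred n)

    multiple-closed : ∀ {d y} → P (ι d) → d ∣ y → P (ι y)
    multiple-closed {d} {y} pd (divides w y≡wd) =
      subst P (trans (pow-ι d w) (cong ι (sym y≡wd))) (pow-closed w pd)

    gcd-closed : ∀ {x} → P x → P (ι (gcd (toℕ x) n))
    gcd-closed {x} px with Bézout.identity (gcd-GCD (toℕ x) n)
    ... | Bézout.+- u v d+vn≡ux = subst P (begin
      ι (u * toℕ x)   ≡⟨ cong ι (sym d+vn≡ux) ⟩
      ι (d + v * n)   ≡⟨ ι-+ d (v * n) ⟩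
      ι d ∙ ι (v * n) ≡⟨ cong (ι d ∙_) (ι-*n v) ⟩
      ι d ∙ ε         ≡⟨ identityʳ (ι d) ⟩
      ι d             ∎) (pow-closed u px)
      where
        open ≡-Reasoning
        d = gcd (toℕ x) n
    ... | Bézout.-+ u v d+ux≡vn = subst P (sym (inverseˡ-unique (ι d) (pow n x u) (begin
      ι d ∙ ι (u * toℕ x) ≡⟨ sym (ι-+ d (u * toℕ x)) ⟩
      ι (d + u * toℕ x)   ≡⟨ cong ι d+ux≡vn ⟩
      ι (v * n)           ≡⟨ ι-*n v ⟩
      ε                   ∎))) (⁻¹-closed (pow-closed u px))
      where
        open ≡-Reasoning
        d = gcd (toℕ x) n

    -- q is the order of x, so this is the uniqueness of the subgroup of each order in a cyclic
    -- group: ⟨x⟩ contains every element whose order divides |x|.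
    order-annihilated-closed : ∀ {x y} q → P x → q * gcd (toℕ x) n ≡ n → pow n y q ≡ ε → P y
    order-annihilated-closed {x} {y} q px q*gcd≡n qy≡ε =
      subst P (ι-toℕ y) (multiple-closed (gcd-closed px) (pow-ε⇒cofactor∣ q y q*gcd≡n qy≡ε))

module SkewMorphism {n : ℕ} .{{_ : NonZero n}} {φ : Fin n → Fin n} (sk : IsSkewMorphism φ) where
  open ℤₙ n
  open IsSkewMorphism sk

  ker-isSubmonoid : IsSubmonoid (InKer φ)
  ker-isSubmonoid = record { ε-closed = ε∈ker ; ∙-closed = ∙∈ker }
    where
      open ≡-Reasoning
      ε∈ker : InKer φ ε
      ε∈ker x = begin
        φ (ε ∙ x)  ≡⟨ cong φ (identityˡ x) ⟩
        φ x        ≡⟨ sym (identityˡ (φ x)) ⟩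
        ε ∙ φ x    ≡⟨ cong (_∙ φ x) (sym fixes-id) ⟩
        φ ε ∙ φ x  ∎
      ∙∈ker : ∀ {a a'} → InKer φ a → InKer φ a' → InKer φ (a ∙ a')
      ∙∈ker {a} {a'} a∈K a'∈K x = begin
        φ ((a ∙ a') ∙ x)    ≡⟨ cong φ (∙-assoc a a' x) ⟩
        φ (a ∙ (a' ∙ x))    ≡⟨ a∈K (a' ∙ x) ⟩
        φ a ∙ φ (a' ∙ x)    ≡⟨ cong (φ a ∙_) (a'∈K x) ⟩
        φ a ∙ (φ a' ∙ φ x)  ≡⟨ sym (∙-assoc (φ a) (φ a') (φ x)) ⟩
        (φ a ∙ φ a') ∙ φ x  ≡⟨ cong (_∙ φ x) (sym (a∈K a')) ⟩
        φ (a ∙ a') ∙ φ x    ∎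

  open IsSubmonoid ker-isSubmonoid

  φ-pow-ker : ∀ {a} m → InKer φ a → φ (pow n a m) ≡ pow n (φ a) m
  φ-pow-ker zero a∈K = fixes-id
  φ-pow-ker {a} (suc m) a∈K = begin
    φ (pow n a (suc m))        ≡⟨ cong φ (pow-suc a m) ⟩
    φ (a ∙ pow n a m)          ≡⟨ a∈K (pow n a m) ⟩
    φ a ∙ φ (pow n a m)        ≡⟨ cong (φ a ∙_) (φ-pow-ker m a∈K) ⟩
    φ a ∙ pow n (φ a) m        ≡⟨ sym (pow-suc (φ a) m) ⟩
    pow n (φ a) (suc m)        ∎
    where open ≡-Reasoning

  φ-preserves-ker : ∀ {a} → InKer φ a → InKer φ (φ a)
  φ-preserves-ker {a} a∈K with gcd[m,n]∣n (toℕ a) n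
  ... | divides q n≡qd = order-annihilated-closed q a∈K (sym n≡qd) (begin
    pow n (φ a) q  ≡⟨ sym (φ-pow-ker q a∈K) ⟩
    φ (pow n a q)  ≡⟨ cong φ (pow-ε-by-cofactor q a (sym n≡qd) (gcd[m,n]∣m (toℕ a) n)) ⟩
    φ ε            ≡⟨ fixes-id ⟩
    ε              ∎)
    where open ≡-Reasoning

  iter-preserves-ker : ∀ {a} m → InKer φ a → InKer φ (iter φ m a)
  iter-preserves-ker zero a∈K = a∈K
  iter-preserves-ker (suc m) a∈K = φ-preserves-ker (iter-preserves-ker m a∈K)

  iter-ε : ∀ m → iter φ m ε ≡ ε
  iter-ε zero = refl
  iter-ε (suc m) = trans (cong φ (iter-ε m)) fixes-id

  iter-∙-ker : ∀ {a} m z → InKer φ a → iter φ m (a ∙ z) ≡ iter φ m a ∙ iter φ m z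
  iter-∙-ker zero z a∈K = refl
  iter-∙-ker {a} (suc m) z a∈K =
    trans (cong φ (iter-∙-ker m z a∈K)) (iter-preserves-ker m a∈K (iter φ m z))

  quotRel⇒sameCosetB : ∀ b k j e' → QuotRel φ b k j e' → SameCosetB φ (iter φ k b) (pow n b j)
  quotRel⇒sameCosetB b k j e' (κ , κ∈K , rel) = iter φ k κ , iter-preserves-ker k κ∈K , (begin
    pow n b j                         ≡⟨ sym (identityʳ _) ⟩
    pow n b j ∙ ε                     ≡⟨ cong (pow n b j ∙_) (sym (iter-ε e')) ⟩
    pow n b j ∙ iter φ e' ε           ≡⟨ rel ε ⟩
    iter φ k (b ∙ (κ ∙ ε))            ≡⟨ cong (λ u → iter φ k (b ∙ u)) (identityʳ κ) ⟩
    iter φ k (b ∙ κ)                  ≡⟨ cong (iter φ k) (∙-comm b κ) ⟩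
    iter φ k (κ ∙ b)                  ≡⟨ iter-∙-ker k b κ∈K ⟩
    iter φ k κ ∙ iter φ k b           ≡⟨ ∙-comm (iter φ k κ) (iter φ k b) ⟩
    iter φ k b ∙ iter φ k κ           ∎)
    where open ≡-Reasoning

  -- f = λ_left ∘ φ^e ∘ λ_right with right ∈ K, i.e. f ∈ λ_B c^e λ_K in G.
  record Factorisation (e : ℕ) (f : Fin n → Fin n) : Set where
    field
      left       : Fin n
      right      : Fin n
      right∈ker  : InKer φ right
      factorises : ∀ x → f x ≡ left ∙ iter φ e (right ∙ x)

  factorisation-cong : ∀ {e f g} → (∀ x → f x ≡ g x) → Factorisation e f → Factorisation e g
  factorisation-cong f≗g F = record
    { left = left ; right = right ; right∈ker = right∈ker
    ; factorises = λ x → trans (sym (f≗g x)) (factorises x)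
    }
    where open Factorisation F

  skew-factorisation : ∀ {a} p → (∀ x → φ (a ∙ x) ≡ φ a ∙ iter φ p x)
                     → Factorisation p (λ x → φ (a ∙ x))
  skew-factorisation {a} p skew-a = record
    { left = φ a ; right = ε ; right∈ker = ε-closed
    ; factorises = λ x → trans (skew-a x) (cong (λ u → φ a ∙ iter φ p u) (sym (identityˡ x)))
    }

  factorisation-step : ∀ b {e e' f} → Factorisation e f → QuotSkewStep φ b e e'
                     → Factorisation e' (f ∘ lreg n b)
  factorisation-step b {e} {e'} {f} F (j , κ' , κ'∈K , rel) = record
    { left = left ∙ pow n b j ; right = κ' \\ right
    ; right∈ker = ∙-closed (⁻¹-closed κ'∈K) right∈ker
    ; factorises = λ x → begin
      f (b ∙ x)                                        ≡⟨ factorises (b ∙ x) ⟩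
      left ∙ iter φ e (right ∙ (b ∙ x))                ≡⟨ cong (λ u → left ∙ iter φ e u) (shuffle x) ⟩
      left ∙ iter φ e (b ∙ (κ' ∙ ((κ' \\ right) ∙ x))) ≡⟨ cong (left ∙_) (sym (rel ((κ' \\ right) ∙ x))) ⟩
      left ∙ (pow n b j ∙ iter φ e' ((κ' \\ right) ∙ x)) ≡⟨ sym (∙-assoc _ _ _) ⟩
      (left ∙ pow n b j) ∙ iter φ e' ((κ' \\ right) ∙ x) ∎
    }
    where
      open ≡-Reasoning
      open Factorisation F
      shuffle : ∀ x → right ∙ (b ∙ x) ≡ b ∙ (κ' ∙ ((κ' \\ right) ∙ x))
      shuffle x = begin
        right ∙ (b ∙ x)                 ≡⟨ x∙yz≈y∙xz right b x ⟩
        b ∙ (right ∙ x)                 ≡⟨ cong (λ u → b ∙ (u ∙ x)) (sym (\\-leftDividesˡ κ' right)) ⟩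
        b ∙ ((κ' ∙ (κ' \\ right)) ∙ x)  ≡⟨ cong (b ∙_) (∙-assoc κ' (κ' \\ right) x) ⟩
        b ∙ (κ' ∙ ((κ' \\ right) ∙ x))  ∎

  -- Comparing the two sides at the identity identifies the left factors, which then cancel.
  iter-unique : ∀ e e' {J J' μ} → InKer φ μ → (∀ z → J ∙ iter φ e z ≡ J' ∙ iter φ e' (μ ∙ z))
              → ∀ z → iter φ e z ≡ iter φ e' z
  iter-unique e e' {J} {J'} {μ} μ∈K rel z = ∙-cancelˡ J _ _ (begin
    J ∙ iter φ e z                       ≡⟨ rel z ⟩
    J' ∙ iter φ e' (μ ∙ z)               ≡⟨ cong (J' ∙_) (iter-∙-ker e' z μ∈K) ⟩
    J' ∙ (iter φ e' μ ∙ iter φ e' z)     ≡⟨ sym (∙-assoc _ _ _) ⟩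
    (J' ∙ iter φ e' μ) ∙ iter φ e' z     ≡⟨ cong (_∙ iter φ e' z) (sym J≡J'μ) ⟩
    J ∙ iter φ e' z                      ∎)
    where
      open ≡-Reasoning
      J≡J'μ : J ≡ J' ∙ iter φ e' μ
      J≡J'μ = begin
        J                          ≡⟨ sym (identityʳ J) ⟩
        J ∙ ε                      ≡⟨ cong (J ∙_) (sym (iter-ε e)) ⟩
        J ∙ iter φ e ε             ≡⟨ rel ε ⟩
        J' ∙ iter φ e' (μ ∙ ε)     ≡⟨ cong (λ u → J' ∙ iter φ e' u) (identityʳ μ) ⟩
        J' ∙ iter φ e' μ           ∎

  factorisation-unique : ∀ {e e' f} → Factorisation e f → Factorisation e' f
                       → ∀ z → iter φ e z ≡ iter φ e' z
  factorisation-unique {e} {e'} F F' = iter-unique e e' (∙-closed κ'∈K (⁻¹-closed κ∈K)) rel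
    where
      open ≡-Reasoning
      open Factorisation F renaming (right to κ; right∈ker to κ∈K)
      open Factorisation F'
        renaming (left to J'; right to κ'; right∈ker to κ'∈K; factorises to factorises')
      rel : ∀ z → left ∙ iter φ e z ≡ J' ∙ iter φ e' ((κ' ∙ κ ⁻¹) ∙ z)
      rel z = begin
        left ∙ iter φ e z                 ≡⟨ cong (λ u → left ∙ iter φ e u) (sym (\\-leftDividesˡ κ z)) ⟩
        left ∙ iter φ e (κ ∙ (κ \\ z))    ≡⟨ sym (factorises (κ \\ z)) ⟩
        _                                 ≡⟨ factorises' (κ \\ z) ⟩
        J' ∙ iter φ e' (κ' ∙ (κ \\ z))    ≡⟨ cong (λ u → J' ∙ iter φ e' u) (sym (∙-assoc κ' (κ ⁻¹) z)) ⟩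
        J' ∙ iter φ e' ((κ' ∙ κ ⁻¹) ∙ z)  ∎

  ≗⇒sameCosetG : ∀ {g h} → (∀ x → h x ≡ g x) → SameCosetG φ g h
  ≗⇒sameCosetG {g} h≗g = ε , ε-closed , λ x → trans (h≗g x) (cong g (sym (identityˡ x)))

  quotient-orbit-factorisation : ∀ b {k} (es : ℕ → ℕ) → es 0 ≡ 1
    → (∀ i → i < k → QuotSkewStep φ b (es i) (es (suc i)))
    → ∀ m → m ≤ k → Factorisation (es m) (λ x → φ (pow n b m ∙ x))
  quotient-orbit-factorisation b es es0≡1 steps zero _ =
    subst (λ e → Factorisation e (λ x → φ (ε ∙ x))) (sym es0≡1) (skew-factorisation 1 ε-closed)
  quotient-orbit-factorisation b es es0≡1 steps (suc m) m<k =
    factorisation-cong b^m∙b∙x≡b^[m+1]∙x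
      (factorisation-step b (quotient-orbit-factorisation b es es0≡1 steps m (<⇒≤ m<k)) (steps m m<k))
    where
      b^m∙b∙x≡b^[m+1]∙x : ∀ x → φ (pow n b m ∙ (b ∙ x)) ≡ φ (pow n b (suc m) ∙ x)
      b^m∙b∙x≡b^[m+1]∙x x =
        cong φ (trans (sym (xy∙z≈y∙xz b (pow n b m) x)) (cong (_∙ x) (sym (pow-suc b m))))

lemma4p1 : (n : ℕ) .{{_ : NonZero n}} (φ : Fin n → Fin n) → IsSkewMorphism φ
    → (b : Fin n) → IsGenerator n b
    → (k : ℕ) → 1 ≤ k
    -- (a): c̄^{π(b^k)} = φ̄^k(c̄), where es 0 = 1 and φ̄(c̄^{es i}) = c̄^{es (i+1)}
    → ((r p : ℕ) → IsOrder φ r → IsPower φ r (pow n b k) p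
        → (es : ℕ → ℕ) → es 0 ≡ 1 → (∀ i → i < k → QuotSkewStep φ b (es i) (es (suc i)))
        → SameCosetG φ (iter φ p) (iter φ (es k)))
    -- (b): π̄(c̄^k) = j (j ∈ {1,…,|B̄|}) implies φ^k(b) ∈ b^j ker φ
    × ((s j e' : ℕ) → IsQuotOrder φ b s → 1 ≤ j → j ≤ s → QuotRel φ b k j e'
        → SameCosetB φ (iter φ k b) (pow n b j))
lemma4p1 n φ sk b _ k _ =
    (λ _ p _ (_ , _ , skew-b^k) es es0≡1 steps →
       ≗⇒sameCosetG (factorisation-unique (quotient-orbit-factorisation b es es0≡1 steps k ≤-refl)
                                           (skew-factorisation p skew-b^k)))
  , (λ _ j e' _ _ _ → quotRel⇒sameCosetB b k j e')
  where open SkewMorphism sk
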